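{- Let $H$ be a graph with vertices $u_1,\dots,u_n$ and let $s\ge 0$ be an integer. Construct an instance $(G,L,f_0,f_t)$ as follows. Use pairwise distinct colors $\star$, $a$, $b$ and $c_i^p$ for $i\in\{1,\dots,s\}$, $p\in\{1,\dots,n\}$. Create selection vertices $v_1,\dots,v_s$ with $L(v_i)=\{\star,c_i^1,\dots,c_i^n\}$. For $i,j\in\{1,\dots,s\}$ and $p,q\in\{1,\dots,n\}$, an $(i,j;p,q)$-forbidding gadget is a new vertex adjacent exactly to $v_i$ and $v_j$, with list $\{c_i^q,c_j^p\}$. For all $1\le i<j\le s$, add an $(i,j;p,p)$-forbidding gadget for every vertex $u_p$ of $H$, and add an $(i,j;p,q)$-forbidding gadget and an $(i,j;q,p)$-forbidding gadget for every edge $u_pu_q$ of $H$. Finally add adjacent vertices $w_1,w_2$ with $L(w_1)=\{a,b\}$, $L(w_2)=\{a,b,\star\}$, and make $w_2$ adjacent to every $v_i$. Let $f_0(v_i)=f_t(v_i)=\star$ for all $i$; let $f_0$ and $f_t$ assign to each gadget vertex an arbitrary color from its list; and let $f_0(w_1)=f_t(w_2)=a$, $f_t(w_1)=f_0(w_2)=b$. Then $H$ has an independent set of size at least $s$ if and only if there is a reconfiguration sequence between $f_0$ and $f_t$, i.e. $(G,L,f_0,f_t)$ is a yes-instance of List Coloring Reconfiguration.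
   Context: Graphs are finite and simple. For a color set $C$, graph $G=(V,E)$ and list $L\colon V\to 2^C$, an $L$-coloring is a map $f\colon V\to C$ with $f(v)\in L(v)$ for all $v$ and $f(v)\ne f(w)$ for every edge $vw$. Two $L$-colorings are adjacent if they differ on exactly one vertex; a reconfiguration sequence is a sequence of $L$-colorings with consecutive ones adjacent. -}

module Defs where

open import Data.Nat using (ℕ; _≤_)
open import Data.Fin using (Fin; _<_; _≟_)
open import Data.Fin.Subset using (Subset; _∈_; ∣_∣)
open import Data.Bool using (Bool; true; false; T; _∨_)
open import Data.List using (List; []; _∷_; map)
open import Data.List.Membership.Propositional renaming (_∈_ to _∈ₗ_)
open import Data.List.Base using ()
open import Data.Fin.Base using ()
open import Data.Product using (Σ; ∃; _×_; _,_)
open import Data.Sum using (_⊎_)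
open import Relation.Nullary using (¬_)
open import Relation.Nullary.Decidable using (⌊_⌋)
open import Relation.Binary.PropositionalEquality using (_≡_)
open import Relation.Binary.Construct.Closure.ReflexiveTransitive using (Star)


-- A finite simple graph on vertex set Fin n (vertex p stands for u_{p+1}),
-- given by a symmetric, irreflexive Boolean adjacency relation.
record Graph (n : ℕ) : Set where
  field
    adj   : Fin n → Fin n → Bool
    sym   : ∀ p q → adj p q ≡ adj q p
    irrefl : ∀ p → adj p p ≡ false
open Graph public

HasIndependentSet : ∀ {n} → Graph n → ℕ → Set
HasIndependentSet {n} H s =
  Σ (Subset n) λ S → (s ≤ ∣ S ∣) × (∀ p q → p ∈ S → q ∈ S → adj H p q ≡ false)

module Construction {n : ℕ} (H : Graph n) (s : ℕ) where

  data Color : Set where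
    star a b : Color
    c : Fin s → Fin n → Color

  -- A forbidding gadget (i,j;p,q) with i<j is present iff p = q (vertex u_p)
  -- or u_p u_q is an edge of H (covering both (p,q) and (q,p)).
  present : Fin n → Fin n → Bool
  present p q = ⌊ p ≟ q ⌋ ∨ adj H p q

  data V : Set where
    sel : Fin s → V
    gad : (i j : Fin s) → i < j →
          (p q : Fin n) → T (present p q) → V
    w₁ w₂ : V

  -- Edges of G (each listed once; adjacency is the symmetric closure).
  data E : V → V → Set where
    gad-i : ∀ i j i<j p q t → E (gad i j i<j p q t) (sel i)
    gad-j : ∀ i j i<j p q t → E (gad i j i<j p q t) (sel j)
    w₁w₂  : E w₁ w₂
    w₂v   : ∀ i → E w₂ (sel i)

  AdjG : V → V → Set
  AdjG x y = E x y ⊎ E y x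

  L : V → List Color
  L (sel i) = star ∷ map (c i) (Data.List.allFin n)
  L (gad i j _ p q _) = c i q ∷ c j p ∷ []
  L w₁ = a ∷ b ∷ []
  L w₂ = a ∷ b ∷ star ∷ []

  record LColoring : Set where
    field
      col    : V → Color
      inL    : ∀ v → col v ∈ₗ L v
      proper : ∀ x y → AdjG x y → ¬ (col x ≡ col y)
  open LColoring public

  Step : LColoring → LColoring → Set
  Step f g = Σ V λ v → ¬ (col f v ≡ col g v) ×
                        (∀ w → ¬ (col f w ≡ col g w) → w ≡ v)

  Reconf : LColoring → LColoring → Set
  Reconf = Star Step

-- If u_{P 1}, …, u_{P s} are independent in H, recolour the gadgets so that
-- they avoid the colours c_i^{P i}; then every v_i can leave ⋆ for c_i^{P i},
-- which frees ⋆ for w₂, so w₂ → ⋆, w₁ → b, w₂ → a, and the v_i and gadgets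
-- are moved back. Conversely w₁ and w₂ cannot exchange a and b in a single
-- step, so some colouring on the way has w₂ = ⋆; there each v_i holds some
-- c_i^{P i}, and the gadgets force the P i to be distinct and pairwise
-- non-adjacent. Each phase of the forward sequence changes an independent set
-- of G, which can be recoloured one vertex at a time.

module Submission where

open import Defs renaming (sym to adj-sym)
open import Data.Nat using (ℕ; zero; suc; _≤_; z≤n; s≤s)
open import Data.Nat.Properties using (≤-trans)
open import Data.Fin using (Fin; zero; suc; lift; _<_; _≟_)
open import Data.Fin.Properties using (any?; suc-injective; lift-injective; 0≢1+n; <-cmp; <⇒≢; <-irrelevant; _<?_)
open import Data.Fin.Subset using (Subset; _∈_; ∣_∣; _-_; inside; outside)
open import Data.Fin.Subset.Properties using (x∈p∧x≢y⇒x∈p-y; x∈p⇒∣p-x∣<∣p∣)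
open import Data.Vec using (_∷_; here; there; tabulate)
open import Data.Vec.Properties using (lookup∘tabulate; lookup⇒[]=; []=⇒lookup)
open import Data.Bool using (true; false; T)
open import Data.Bool.Properties using (T-∨; T-≡; T-irrelevant; T?)
open import Data.Unit using (tt)
open import Data.List using (List; []; _∷_; map; concatMap; _++_; allFin; cartesianProduct)
open import Data.List.Membership.Propositional using (lose) renaming (_∈_ to _∈ₗ_; _∉_ to _∉ₗ_)
open import Data.List.Membership.Propositional.Properties
  using (∈-allFin; ∈-map⁺; ∈-map⁻; ∈-concatMap⁺; ∈-cartesianProduct⁺; ∈-++⁺ˡ; ∈-++⁺ʳ)
open import Data.List.Relation.Unary.Any using (here; there; toSum)
open import Data.Product using (Σ; ∃; _×_; _,_; proj₁; proj₂)
open import Data.Sum using (_⊎_; inj₁; inj₂; [_,_]′)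
open import Data.Empty using (⊥-elim)
open import Function using (_∘_; id)
open import Function.Bundles using (_⇔_; mk⇔; Equivalence)
open import Function.Definitions using (Injective)
open import Relation.Nullary using (¬_; yes; no)
open import Relation.Nullary.Decidable using (⌊_⌋; map′; _×-dec_; toWitness; fromWitness)
open import Relation.Binary.Definitions using (DecidableEquality; tri<; tri≈; tri>)
open import Relation.Binary.PropositionalEquality using (_≡_; _≢_; refl; sym; trans; cong; cong₂; subst)
open import Relation.Binary.Construct.Closure.ReflexiveTransitive using (Star; ε; _◅_; _◅◅_; fold)

InjectionInto : ∀ {n} → ℕ → Subset n → Set
InjectionInto {n} s p = Σ (Fin s → Fin n) λ f → (∀ i → f i ∈ p) × Injective _≡_ _≡_ f

≤∣p∣⇒injectionInto : ∀ {n s} (p : Subset n) → s ≤ ∣ p ∣ → InjectionInto s p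
≤∣p∣⇒injectionInto {s = zero} p _ = (λ ()) , (λ ()) , λ {}
≤∣p∣⇒injectionInto {s = suc s} (inside ∷ p) (s≤s s≤∣p∣) with ≤∣p∣⇒injectionInto p s≤∣p∣
... | f , f∈p , f-inj = lift 1 f , lift-into , lift-injective f f-inj 1
  where
  lift-into : ∀ i → lift 1 f i ∈ inside ∷ p
  lift-into zero    = here
  lift-into (suc i) = there (f∈p i)
≤∣p∣⇒injectionInto {s = suc s} (outside ∷ p) s≤∣p∣ with ≤∣p∣⇒injectionInto p s≤∣p∣
... | f , f∈p , f-inj = suc ∘ f , there ∘ f∈p , f-inj ∘ suc-injective

injectionInto⇒≤∣p∣ : ∀ {n s} (p : Subset n) → InjectionInto s p → s ≤ ∣ p ∣
injectionInto⇒≤∣p∣ {s = zero}  p _ = z≤n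
injectionInto⇒≤∣p∣ {s = suc s} p (f , f∈p , f-inj) =
  ≤-trans (s≤s (injectionInto⇒≤∣p∣ (p - f zero) (f ∘ suc , f∘suc∈p-f0 , suc-injective ∘ f-inj)))
          (x∈p⇒∣p-x∣<∣p∣ (f∈p zero))
  where
  f∘suc∈p-f0 : ∀ i → f (suc i) ∈ p - f zero
  f∘suc∈p-f0 i = x∈p∧x≢y⇒x∈p-y (f∈p (suc i)) (0≢1+n ∘ f-inj ∘ sym)

image : ∀ {s n} → (Fin s → Fin n) → Subset n
image f = tabulate λ q → ⌊ any? (λ i → f i ≟ q) ⌋

∈-image⁺ : ∀ {s n} (f : Fin s → Fin n) i → f i ∈ image f
∈-image⁺ f i = lookup⇒[]= (f i) (image f)
  (trans (lookup∘tabulate _ (f i)) (Equivalence.to T-≡ (fromWitness {a? = any? λ j → f j ≟ f i} (i , refl))))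

∈-image⁻ : ∀ {s n} (f : Fin s → Fin n) q → q ∈ image f → ∃ λ i → f i ≡ q
∈-image⁻ f q q∈ = toWitness {a? = any? λ i → f i ≟ q}
  (Equivalence.from T-≡ (trans (sym (lookup∘tabulate _ q)) ([]=⇒lookup q∈)))

module Reduction {n} (H : Graph n) (s : ℕ) where
  open Construction H s

  IndependentFamily : (Fin s → Fin n) → Set
  IndependentFamily P = Injective _≡_ _≡_ P × (∀ i j → adj H (P i) (P j) ≡ false)

  hasIndependentSet⇒family : HasIndependentSet H s → ∃ IndependentFamily
  hasIndependentSet⇒family (S , s≤∣S∣ , S-indep) with ≤∣p∣⇒injectionInto S s≤∣S∣
  ... | P , P∈S , P-inj = P , P-inj , λ i j → S-indep (P i) (P j) (P∈S i) (P∈S j)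

  family⇒hasIndependentSet : ∀ {P} → IndependentFamily P → HasIndependentSet H s
  family⇒hasIndependentSet {P} (P-inj , P-indep) =
    image P , injectionInto⇒≤∣p∣ (image P) (P , ∈-image⁺ P , P-inj) , image-indep
    where
    image-indep : ∀ p q → p ∈ image P → q ∈ image P → adj H p q ≡ false
    image-indep p q p∈ q∈ with ∈-image⁻ P p p∈ | ∈-image⁻ P q q∈
    ... | i , refl | j , refl = P-indep i j

  present-refl : ∀ {p q} → p ≡ q → T (present p q)
  present-refl {p} {q} p≡q = Equivalence.from T-∨ (inj₁ (fromWitness {a? = p ≟ q} p≡q))

  absent⇒nonadjacent : ∀ {p q} → ¬ T (present p q) → adj H p q ≡ false
  absent⇒nonadjacent {p} {q} ¬t with adj H p q
  ... | false = refl
  ... | true  = ⊥-elim (¬t (Equivalence.from T-∨ (inj₂ tt)))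

  -- No gadget forbids colouring every v_i with c i (P i).
  Permitted : (Fin s → Fin n) → Set
  Permitted P = ∀ {i j} → i < j → ¬ T (present (P j) (P i))

  family⇒permitted : ∀ {P} → IndependentFamily P → Permitted P
  family⇒permitted {P} (P-inj , P-indep) {i} {j} i<j t with Equivalence.to T-∨ t
  ... | inj₁ Pj≡Pi    = <⇒≢ i<j (sym (P-inj (toWitness Pj≡Pi)))
  ... | inj₂ Pj-Pi-adj = subst T (P-indep j i) Pj-Pi-adj

  permitted⇒family : ∀ {P} → Permitted P → IndependentFamily P
  permitted⇒family {P} permitted = P-inj , P-indep
    where
    P-inj : Injective _≡_ _≡_ P
    P-inj {i} {j} Pi≡Pj with <-cmp i j
    ... | tri< i<j _ _ = ⊥-elim (permitted i<j (present-refl (sym Pi≡Pj)))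
    ... | tri≈ _ i≡j _ = i≡j
    ... | tri> _ _ j<i = ⊥-elim (permitted j<i (present-refl Pi≡Pj))
    P-indep : ∀ i j → adj H (P i) (P j) ≡ false
    P-indep i j with <-cmp i j
    ... | tri< i<j _ _  = trans (adj-sym H (P i) (P j)) (absent⇒nonadjacent (permitted i<j))
    ... | tri≈ _ refl _ = irrefl H (P i)
    ... | tri> _ _ j<i  = absent⇒nonadjacent (permitted j<i)

  c-injective : ∀ {i j p q} → c i p ≡ c j q → i ≡ j × p ≡ q
  c-injective refl = refl , refl

  _≟ᶜ_ : DecidableEquality Color
  star  ≟ᶜ star  = yes refl
  a     ≟ᶜ a     = yes refl
  b     ≟ᶜ b     = yes refl
  c i p ≟ᶜ c j q = map′ (λ { (refl , refl) → refl }) c-injective (i ≟ j ×-dec p ≟ q)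
  star  ≟ᶜ a     = no λ ()
  star  ≟ᶜ b     = no λ ()
  star  ≟ᶜ c _ _ = no λ ()
  a     ≟ᶜ star  = no λ ()
  a     ≟ᶜ b     = no λ ()
  a     ≟ᶜ c _ _ = no λ ()
  b     ≟ᶜ star  = no λ ()
  b     ≟ᶜ a     = no λ ()
  b     ≟ᶜ c _ _ = no λ ()
  c _ _ ≟ᶜ star  = no λ ()
  c _ _ ≟ᶜ a     = no λ ()
  c _ _ ≟ᶜ b     = no λ ()

  _≟ᵛ_ : DecidableEquality V
  sel i ≟ᵛ sel j = map′ (cong sel) (λ { refl → refl }) (i ≟ j)
  gad i j i<j p q t ≟ᵛ gad i′ j′ i′<j′ p′ q′ t′ =
    map′ (λ { (refl , refl , refl , refl) →
              cong₂ (λ i<j t → gad i j i<j p q t) (<-irrelevant i<j i′<j′) (T-irrelevant t t′) })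
         (λ { refl → refl , refl , refl , refl })
         (i ≟ i′ ×-dec j ≟ j′ ×-dec p ≟ p′ ×-dec q ≟ q′)
  w₁ ≟ᵛ w₁ = yes refl
  w₂ ≟ᵛ w₂ = yes refl
  sel _ ≟ᵛ gad _ _ _ _ _ _ = no λ ()
  sel _ ≟ᵛ w₁ = no λ ()
  sel _ ≟ᵛ w₂ = no λ ()
  gad _ _ _ _ _ _ ≟ᵛ sel _ = no λ ()
  gad _ _ _ _ _ _ ≟ᵛ w₁ = no λ ()
  gad _ _ _ _ _ _ ≟ᵛ w₂ = no λ ()
  w₁ ≟ᵛ sel _ = no λ ()
  w₁ ≟ᵛ gad _ _ _ _ _ _ = no λ ()
  w₁ ≟ᵛ w₂ = no λ ()
  w₂ ≟ᵛ sel _ = no λ ()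
  w₂ ≟ᵛ gad _ _ _ _ _ _ = no λ ()
  w₂ ≟ᵛ w₁ = no λ ()

  gadgetsAt : (Fin s × Fin s) × (Fin n × Fin n) → List V
  gadgetsAt ((i , j) , (p , q)) with i <? j | T? (present p q)
  ... | yes i<j | yes t = gad i j i<j p q t ∷ []
  ... | _       | _     = []

  ∈-gadgetsAt : ∀ {i j} (i<j : i < j) p q t → gad i j i<j p q t ∈ₗ gadgetsAt ((i , j) , (p , q))
  ∈-gadgetsAt {i} {j} i<j p q t with i <? j | T? (present p q)
  ... | yes i<j′ | yes t′ rewrite <-irrelevant i<j i<j′ | T-irrelevant t t′ = here refl
  ... | no i≮j   | _      = ⊥-elim (i≮j i<j)
  ... | yes _    | no ¬t  = ⊥-elim (¬t t)

  gadgets : List V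
  gadgets = concatMap gadgetsAt
    (cartesianProduct (cartesianProduct (allFin s) (allFin s)) (cartesianProduct (allFin n) (allFin n)))

  vertices : List V
  vertices = map sel (allFin s) ++ gadgets ++ w₁ ∷ w₂ ∷ []

  ∈-vertices : ∀ v → v ∈ₗ vertices
  ∈-vertices (sel i) = ∈-++⁺ˡ (∈-map⁺ sel (∈-allFin i))
  ∈-vertices (gad i j i<j p q t) = ∈-++⁺ʳ (map sel (allFin s)) (∈-++⁺ˡ (∈-concatMap⁺ gadgetsAt (lose
    (∈-cartesianProduct⁺ (∈-cartesianProduct⁺ (∈-allFin i) (∈-allFin j))
                         (∈-cartesianProduct⁺ (∈-allFin p) (∈-allFin q)))
    (∈-gadgetsAt i<j p q t))))
  ∈-vertices w₁ = ∈-++⁺ʳ (map sel (allFin s)) (∈-++⁺ʳ gadgets (here refl))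
  ∈-vertices w₂ = ∈-++⁺ʳ (map sel (allFin s)) (∈-++⁺ʳ gadgets (there (here refl)))

  mkLColoring : (κ : V → Color) → (∀ v → κ v ∈ₗ L v) → (∀ {x y} → E x y → κ x ≢ κ y) → LColoring
  mkLColoring κ κ∈L κ-proper = record
    { col    = κ
    ; inL    = κ∈L
    ; proper = λ { _ _ (inj₁ xy) → κ-proper xy ; _ _ (inj₂ yx) → κ-proper yx ∘ sym }
    }

  _≈_ : LColoring → LColoring → Set
  f ≈ g = ∀ v → col f v ≡ col g v

  IndependentChange : LColoring → LColoring → Set
  IndependentChange f g = ∀ x y → E x y → col f x ≡ col g x ⊎ col f y ≡ col g y

  module Interpolation (f g : LColoring) (change : IndependentChange f g)
                       (κ : V → Color) (κ-from : ∀ v → κ v ≡ col f v ⊎ κ v ≡ col g v) where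

    pinned : ∀ {v} → col f v ≡ col g v → κ v ≡ col f v × κ v ≡ col g v
    pinned {v} fv≡gv with κ-from v
    ... | inj₁ κv≡fv = κv≡fv , trans κv≡fv fv≡gv
    ... | inj₂ κv≡gv = trans κv≡gv (sym fv≡gv) , κv≡gv

    pinned-clash : ∀ {x y} → AdjG x y → κ x ≡ col f x × κ x ≡ col g x → κ x ≢ κ y
    pinned-clash {x} {y} xy (κx≡fx , κx≡gx) κx≡κy with κ-from y
    ... | inj₁ κy≡fy = proper f x y xy (trans (sym κx≡fx) (trans κx≡κy κy≡fy))
    ... | inj₂ κy≡gy = proper g x y xy (trans (sym κx≡gx) (trans κx≡κy κy≡gy))

    interpolant : LColoring
    interpolant = mkLColoring κ κ∈L κ-proper
      where
      κ∈L : ∀ v → κ v ∈ₗ L v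
      κ∈L v = [ (λ κv≡fv → subst (_∈ₗ L v) (sym κv≡fv) (inL f v))
              , (λ κv≡gv → subst (_∈ₗ L v) (sym κv≡gv) (inL g v)) ]′ (κ-from v)
      κ-proper : ∀ {x y} → E x y → κ x ≢ κ y
      κ-proper {x} {y} xy with change x y xy
      ... | inj₁ fx≡gx = pinned-clash (inj₁ xy) (pinned fx≡gx)
      ... | inj₂ fy≡gy = pinned-clash (inj₂ xy) (pinned fy≡gy) ∘ sym

    interpolant-change : IndependentChange interpolant g
    interpolant-change x y xy with change x y xy
    ... | inj₁ fx≡gx = inj₁ (proj₂ (pinned fx≡gx))
    ... | inj₂ fy≡gy = inj₂ (proj₂ (pinned fy≡gy))

  module RecolourVertex (f g : LColoring) (change : IndependentChange f g) (d : V) where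

    κ : V → Color
    κ v with v ≟ᵛ d
    ... | yes _ = col g v
    ... | no  _ = col f v

    κ-at : κ d ≡ col g d
    κ-at with d ≟ᵛ d
    ... | yes _   = refl
    ... | no  d≢d = ⊥-elim (d≢d refl)

    κ-agrees : ∀ {ds} → (∀ v → v ∉ₗ d ∷ ds → col f v ≡ col g v) →
               ∀ v → v ∉ₗ ds → κ v ≡ col g v
    κ-agrees agree v v∉ds with v ≟ᵛ d
    ... | yes _   = refl
    ... | no  v≢d = agree v ([ v≢d , v∉ds ]′ ∘ toSum)

    κ-from : ∀ v → κ v ≡ col f v ⊎ κ v ≡ col g v
    κ-from v with v ≟ᵛ d
    ... | yes _ = inj₂ refl
    ... | no  _ = inj₁ refl

    open Interpolation f g change κ κ-from public using (interpolant; interpolant-change)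

    step : col f d ≢ col g d → Step f interpolant
    step fd≢gd = d , (λ fd≡κd → fd≢gd (trans fd≡κd κ-at)) , only-d
      where
      only-d : ∀ v → col f v ≢ κ v → v ≡ d
      only-d v fv≢κv with v ≟ᵛ d
      ... | yes v≡d = v≡d
      ... | no  _   = ⊥-elim (fv≢κv refl)

  Step-resp-≈ : ∀ {f f′ g g′} → f ≈ f′ → g ≈ g′ → Step f g → Step f′ g′
  Step-resp-≈ f≈f′ g≈g′ (v , fv≢gv , only-v) =
    v , (λ eq → fv≢gv (trans (f≈f′ v) (trans eq (sym (g≈g′ v))))) ,
    λ w f′w≢g′w → only-v w (λ eq → f′w≢g′w (trans (sym (f≈f′ w)) (trans eq (g≈g′ w))))

  -- Reconfiguration up to equal colours: LColoring also carries proofs, so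
  -- colourings built independently with the same colours need not be equal.
  record _⇝_ (f g : LColoring) : Set where
    constructor reach
    field
      {target} : LColoring
      path     : Star Step f target
      target≈  : target ≈ g

  ⇝-trans : ∀ {f g h} → f ⇝ g → g ⇝ h → f ⇝ h
  ⇝-trans (reach f→k k≈g) (reach ε l≈h) = reach f→k λ v → trans (k≈g v) (l≈h v)
  ⇝-trans {g = g} (reach {k} f→k k≈g) (reach (_◅_ {j = m} step g→l) l≈h) =
    reach (f→k ◅◅ (Step-resp-≈ {g} {k} {m} {m} (sym ∘ k≈g) (λ _ → refl) step ◅ g→l)) l≈h

  ⇝-chain : ∀ {f g} → Star _⇝_ f g → f ⇝ g
  ⇝-chain = fold _⇝_ ⇝-trans (reach ε λ _ → refl)

  retarget : ∀ {f h g} → Star Step f h → h ≈ g → Star Step f g ⊎ f ≈ g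
  retarget ε f≈g = inj₂ f≈g
  retarget {f} {g = g} (_◅_ {j = k} step rest) h≈g with retarget rest h≈g
  ... | inj₁ k→g = inj₁ (step ◅ k→g)
  ... | inj₂ k≈g = inj₁ (Step-resp-≈ {f} {f} {k} {g} (λ _ → refl) k≈g step ◅ ε)

  ⇝⇒Reconf : ∀ {f g} → ¬ f ≈ g → f ⇝ g → Reconf f g
  ⇝⇒Reconf f≉g (reach f→h h≈g) = [ id , ⊥-elim ∘ f≉g ]′ (retarget f→h h≈g)

  recolour : ∀ ds f g → IndependentChange f g → (∀ v → v ∉ₗ ds → col f v ≡ col g v) → f ⇝ g
  recolour [] f g _ agree = reach ε λ v → agree v λ ()
  recolour (d ∷ ds) f g change agree with col f d ≟ᶜ col g d
  ... | yes fd≡gd = recolour ds f g change agree′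
    where
    agree′ : ∀ v → v ∉ₗ ds → col f v ≡ col g v
    agree′ v v∉ds with v ≟ᵛ d
    ... | yes refl = fd≡gd
    ... | no  v≢d  = agree v ([ v≢d , v∉ds ]′ ∘ toSum)
  ... | no fd≢gd = prepend (recolour ds interpolant g interpolant-change (κ-agrees agree))
    where
    open RecolourVertex f g change d
    prepend : interpolant ⇝ g → f ⇝ g
    prepend (reach f′→h h≈g) = reach (step fd≢gd ◅ f′→h) h≈g

  ⇝-of-change : ∀ f g → IndependentChange f g → f ⇝ g
  ⇝-of-change f g change = recolour vertices f g change λ v v∉ → ⊥-elim (v∉ (∈-vertices v))

  ⇝-fixingSelections : ∀ f g → (∀ i → col f (sel i) ≡ col g (sel i)) →
    col f w₁ ≡ col g w₁ ⊎ col f w₂ ≡ col g w₂ → f ⇝ g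
  ⇝-fixingSelections f g fixed w-fixed = ⇝-of-change f g λ
    { _ _ (gad-i i _ _ _ _ _) → inj₂ (fixed i)
    ; _ _ (gad-j _ j _ _ _ _) → inj₂ (fixed j)
    ; _ _ w₁w₂                → w-fixed
    ; _ _ (w₂v i)             → inj₂ (fixed i)
    }

  ⇝-fixingGadgets : ∀ f g →
    (∀ {i j} (i<j : i < j) p q t → col f (gad i j i<j p q t) ≡ col g (gad i j i<j p q t)) →
    col f w₂ ≡ col g w₂ → f ⇝ g
  ⇝-fixingGadgets f g fixed w₂-fixed = ⇝-of-change f g λ
    { _ _ (gad-i _ _ i<j p q t) → inj₁ (fixed i<j p q t)
    ; _ _ (gad-j _ _ i<j p q t) → inj₁ (fixed i<j p q t)
    ; _ _ w₁w₂                  → inj₂ w₂-fixed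
    ; _ _ (w₂v _)               → inj₁ w₂-fixed
    }

  module Forward {P : Fin s → Fin n} (permitted : Permitted P) where

    -- The colour of gadget (i,j;p,q) while the v_i select: it avoids c i (P i),
    -- and it can only hit c j (P j) if (p , q) = (P j , P i), which P forbids.
    parked : Fin s → Fin s → Fin n → Fin n → Color
    parked i j p q with q ≟ P i
    ... | yes _ = c j p
    ... | no  _ = c i q

    parked∈L : ∀ {i j} (i<j : i < j) p q t → parked i j p q ∈ₗ L (gad i j i<j p q t)
    parked∈L {i} _ p q _ with q ≟ P i
    ... | yes _ = there (here refl)
    ... | no  _ = here refl

    parked≢star : ∀ {i j p q} → parked i j p q ≢ star
    parked≢star {i} {q = q} with q ≟ P i
    ... | yes _ = λ ()
    ... | no  _ = λ ()

    parked≢choiceˡ : ∀ {i j p q} → i < j → parked i j p q ≢ c i (P i)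
    parked≢choiceˡ {i} {q = q} i<j with q ≟ P i
    ... | yes _   = <⇒≢ i<j ∘ sym ∘ proj₁ ∘ c-injective
    ... | no q≢Pi = q≢Pi ∘ proj₂ ∘ c-injective

    parked≢choiceʳ : ∀ {i j p q} → i < j → T (present p q) → parked i j p q ≢ c j (P j)
    parked≢choiceʳ {i} {q = q} i<j t with q ≟ P i
    ... | yes refl = λ eq → permitted i<j (subst (λ p → T (present p (P i))) (proj₂ (c-injective eq)) t)
    ... | no  _    = <⇒≢ i<j ∘ proj₁ ∘ c-injective

    record Selection : Set where
      field
        choice        : Fin s → Color
        choice∈L      : ∀ i → choice i ∈ₗ L (sel i)
        parked≢choice : ∀ {i j} → i < j → ∀ {p q} → T (present p q) →
                        parked i j p q ≢ choice i × parked i j p q ≢ choice j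

    idle : Selection
    idle = record
      { choice        = λ _ → star
      ; choice∈L      = λ _ → here refl
      ; parked≢choice = λ _ _ → parked≢star , parked≢star
      }

    chosen : Selection
    chosen = record
      { choice        = λ i → c i (P i)
      ; choice∈L      = λ i → there (∈-map⁺ (c i) (∈-allFin (P i)))
      ; parked≢choice = λ i<j t → parked≢choiceˡ i<j , parked≢choiceʳ i<j t
      }

    frame : (σ : Selection) (c₁ c₂ : Color) → c₁ ∈ₗ L w₁ → c₂ ∈ₗ L w₂ → c₁ ≢ c₂ →
            (∀ i → c₂ ≢ Selection.choice σ i) → LColoring
    frame σ c₁ c₂ c₁∈L c₂∈L c₁≢c₂ c₂≢choice = mkLColoring κ κ∈L κ-proper
      where
      open Selection σ
      κ : V → Color
      κ (sel i)            = choice i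
      κ (gad i j _ p q _)  = parked i j p q
      κ w₁                 = c₁
      κ w₂                 = c₂
      κ∈L : ∀ v → κ v ∈ₗ L v
      κ∈L (sel i)             = choice∈L i
      κ∈L (gad _ _ i<j p q t) = parked∈L i<j p q t
      κ∈L w₁                  = c₁∈L
      κ∈L w₂                  = c₂∈L
      κ-proper : ∀ {x y} → E x y → κ x ≢ κ y
      κ-proper (gad-i _ _ i<j _ _ t) = proj₁ (parked≢choice i<j t)
      κ-proper (gad-j _ _ i<j _ _ t) = proj₂ (parked≢choice i<j t)
      κ-proper w₁w₂                  = c₁≢c₂
      κ-proper (w₂v i)               = c₂≢choice i

    reconfigure : ∀ {f g} → (∀ i → col f (sel i) ≡ star) → col f w₁ ≡ a →
                  (∀ i → col g (sel i) ≡ star) → col g w₁ ≡ b → f ⇝ g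
    reconfigure {f} {g} f-sel f-w₁ g-sel g-w₁ = ⇝-chain
      ( ⇝-fixingSelections f F₁ f-sel (inj₁ f-w₁)
      ◅ ⇝-fixingGadgets    F₁ F₂ (λ _ _ _ _ → refl) refl
      ◅ ⇝-fixingSelections F₂ F₃ (λ _ → refl) (inj₁ refl)
      ◅ ⇝-fixingSelections F₃ F₄ (λ _ → refl) (inj₂ refl)
      ◅ ⇝-fixingSelections F₄ F₅ (λ _ → refl) (inj₁ refl)
      ◅ ⇝-fixingGadgets    F₅ F₆ (λ _ _ _ _ → refl) refl
      ◅ ⇝-fixingSelections F₆ g  (sym ∘ g-sel) (inj₁ (sym g-w₁))
      ◅ ε)
      where
      F₁ F₂ F₃ F₄ F₅ F₆ : LColoring
      F₁ = frame idle   a b    (here refl)         (there (here refl))         (λ ()) (λ _ ())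
      F₂ = frame chosen a b    (here refl)         (there (here refl))         (λ ()) (λ _ ())
      F₃ = frame chosen a star (here refl)         (there (there (here refl))) (λ ()) (λ _ ())
      F₄ = frame chosen b star (there (here refl)) (there (there (here refl))) (λ ()) (λ _ ())
      F₅ = frame chosen b a    (there (here refl)) (here refl)                 (λ ()) (λ _ ())
      F₆ = frame idle   b a    (there (here refl)) (here refl)                 (λ ()) (λ _ ())

  a≢b : a ≢ b
  a≢b ()

  Locked : LColoring → Set
  Locked h = col h w₁ ≡ a × col h w₂ ≡ b

  Step-changes-one-vertex : ∀ {h h′ x y} → Step h h′ →
    col h x ≢ col h′ x → col h y ≢ col h′ y → x ≡ y
  Step-changes-one-vertex (_ , _ , only-v) x-changed y-changed =
    trans (only-v _ x-changed) (sym (only-v _ y-changed))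

  w₁≢w₂ : ∀ h → col h w₁ ≢ col h w₂
  w₁≢w₂ h = proper h w₁ w₂ (inj₁ w₁w₂)

  w₂≢⋆⇒locked⊎swapped : ∀ h → col h w₂ ≢ star → Locked h ⊎ (col h w₁ ≡ b × col h w₂ ≡ a)
  w₂≢⋆⇒locked⊎swapped h w₂≢⋆ with inL h w₁ | inL h w₂
  ... | here w₁≡a         | there (here w₂≡b) = inj₁ (w₁≡a , w₂≡b)
  ... | there (here w₁≡b) | here w₂≡a         = inj₂ (w₁≡b , w₂≡a)
  ... | here w₁≡a         | here w₂≡a         = ⊥-elim (w₁≢w₂ h (trans w₁≡a (sym w₂≡a)))
  ... | there (here w₁≡b) | there (here w₂≡b) = ⊥-elim (w₁≢w₂ h (trans w₁≡b (sym w₂≡b)))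
  ... | _                 | there (there (here w₂≡⋆)) = ⊥-elim (w₂≢⋆ w₂≡⋆)

  Step-preserves-Locked : ∀ {h h′} → Locked h → Step h h′ → col h′ w₂ ≢ star → Locked h′
  Step-preserves-Locked {h} {h′} (h-w₁ , h-w₂) step w₂≢⋆ with w₂≢⋆⇒locked⊎swapped h′ w₂≢⋆
  ... | inj₁ locked = locked
  ... | inj₂ (h′-w₁ , h′-w₂)
    with Step-changes-one-vertex {h} {h′} step
           (λ eq → a≢b (trans (sym h-w₁) (trans eq h′-w₁)))
           (λ eq → a≢b (sym (trans (sym h-w₂) (trans eq h′-w₂))))
  ... | ()

  Reconf-passes-w₂-star : ∀ {f g} → Star Step f g → Locked f → ¬ Locked g → ∃ λ h → col h w₂ ≡ star
  Reconf-passes-w₂-star ε locked unlocked = ⊥-elim (unlocked locked)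
  Reconf-passes-w₂-star {f} (_◅_ {j = h} step rest) locked unlocked with col h w₂ ≟ᶜ star
  ... | yes h-w₂≡⋆ = h , h-w₂≡⋆
  ... | no  h-w₂≢⋆ =
    Reconf-passes-w₂-star rest (Step-preserves-Locked {f} {h} locked step h-w₂≢⋆) unlocked

  -- Each v_i must then hold some c i (P i), and a gadget (i,j;P j,P i) would
  -- find both of its colours taken.
  w₂-star⇒permitted : ∀ h → col h w₂ ≡ star → ∃ Permitted
  w₂-star⇒permitted h h-w₂ = P , permitted
    where
    selected : ∀ i → ∃ λ q → col h (sel i) ≡ c i q
    selected i with inL h (sel i)
    ... | here sel≡⋆ = ⊥-elim (proper h w₂ (sel i) (inj₁ (w₂v i)) (trans h-w₂ (sym sel≡⋆)))
    ... | there sel∈c with ∈-map⁻ (c i) sel∈c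
    ...   | q , _ , sel≡c = q , sel≡c
    P : Fin s → Fin n
    P = proj₁ ∘ selected
    P-selected : ∀ i → col h (sel i) ≡ c i (P i)
    P-selected = proj₂ ∘ selected
    permitted : Permitted P
    permitted {i} {j} i<j t with inL h (gad i j i<j (P j) (P i) t)
    ... | here gad≡ci =
      proper h _ (sel i) (inj₁ (gad-i i j i<j _ _ t)) (trans gad≡ci (sym (P-selected i)))
    ... | there (here gad≡cj) =
      proper h _ (sel j) (inj₁ (gad-j i j i<j _ _ t)) (trans gad≡cj (sym (P-selected j)))

lemma6 : ∀ {n} (H : Graph n) (s : ℕ) →
         (f₀ fₜ : Construction.LColoring H s) →
         (∀ i → Construction.col f₀ (Construction.sel i) ≡ Construction.star) →
         (∀ i → Construction.col fₜ (Construction.sel i) ≡ Construction.star) →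
         Construction.col f₀ Construction.w₁ ≡ Construction.a →
         Construction.col fₜ Construction.w₂ ≡ Construction.a →
         Construction.col fₜ Construction.w₁ ≡ Construction.b →
         Construction.col f₀ Construction.w₂ ≡ Construction.b →
         (HasIndependentSet H s ⇔ Construction.Reconf H s f₀ fₜ)
lemma6 H s f₀ fₜ f₀-sel fₜ-sel f₀-w₁ fₜ-w₂ fₜ-w₁ f₀-w₂ = mk⇔ forward backward
  where
  open Construction H s
  open Reduction H s

  forward : HasIndependentSet H s → Reconf f₀ fₜ
  forward independent =
    let P , family = hasIndependentSet⇒family independent in
    ⇝⇒Reconf (λ f₀≈fₜ → a≢b (trans (sym f₀-w₁) (trans (f₀≈fₜ w₁) fₜ-w₁)))
             (Forward.reconfigure (family⇒permitted family) f₀-sel f₀-w₁ fₜ-sel fₜ-w₁)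

  backward : Reconf f₀ fₜ → HasIndependentSet H s
  backward r =
    let h , h-w₂ = Reconf-passes-w₂-star r (f₀-w₁ , f₀-w₂) fₜ-unlocked in
    family⇒hasIndependentSet (permitted⇒family (proj₂ (w₂-star⇒permitted h h-w₂)))
    where
    fₜ-unlocked : ¬ Locked fₜ
    fₜ-unlocked (_ , fₜ-w₂≡b) = a≢b (trans (sym fₜ-w₂) fₜ-w₂≡b)
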